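{- Let $d\ge2$, $1\le k\le d$, and $S=\{0=s_1<\dots<s_k\}\subseteq\{0,\dots,d-1\}$. Put $\delta_i=s_{i+1}-s_i$ for $i=1,\dots,k-1$ and $\delta_k=\pi(S)=d-s_k$, indices of $\delta$ taken mod $k$. For $j=0,\dots,k-1$ let $S^{(j)}$ be the subset of $\{0,\dots,d-1\}$ with first element $0$ and difference vector $[\delta_{k-j+1},\delta_{k-j+2},\dots,\delta_{k-j-1}]$ (the $k-1$ consecutive terms of the cyclic sequence $\delta_1,\dots,\delta_k$ starting at $\delta_{k-j+1}$; so $S^{(0)}=S$ and $S^{(1)}$ has difference vector $[\delta_k,\delta_1,\dots,\delta_{k-2}]$), whose positioning value is $\delta_{k-j}$. Suppose $S^{(0)},\dots,S^{(k-1)}$ are pairwise distinct. Then the orbit of $S$ under translation by $\mathbb{Z}/d\mathbb{Z}$ is the disjoint union of the blocks \[ B_j(S)=\{\{t|\delta(S^{(j)})\}: t=0,1,\dots,\delta_{k-j}-1\},\qquad j=0,\dots,k-1, \] where $\{t|\delta(S^{(j)})\}=\{t+x: x\in S^{(j)}\}$.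
   Context: For a subset $T=\{t_1<\dots<t_k\}$ of $\{0,\dots,d-1\}$, its difference vector is $[t_2-t_1,\dots,t_k-t_{k-1}]$ and its positioning value is $d-t_k+t_1$. Translation by $\nu\in\mathbb{Z}/d\mathbb{Z}$ sends $T$ to $\{(t+\nu)\bmod d\}$. -}

module Defs where

open import Data.Nat using (ℕ; zero; suc; _+_; _∸_; _<_; _<ᵇ_)
open import Data.Nat.Properties using (_≟_)
open import Data.Bool using (if_then_else_)
open import Data.List using (List; map; upTo)
open import Data.Fin using (toℕ)
open import Data.Fin.Subset using (Subset)
open import Data.Vec using (tabulate)
open import Data.List.Membership.DecPropositional _≟_ using (_∈?_)
open import Relation.Nullary using (does)

-- The subset of {0,…,d-1} (as a Data.Fin.Subset) whose members are the
-- entries of the list xs that are < d.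
setOf : (d : ℕ) → List ℕ → Subset d
setOf d xs = tabulate (λ i → does (toℕ i ∈? xs))

psum : ℕ → (ℕ → ℕ) → ℕ
psum zero    f = 0
psum (suc m) f = psum m f + f m

-- The set S = {s_0 < … < s_{k-1}} (0-indexed) inside {0,…,d-1}.
elemsS : (k : ℕ) → (s : ℕ → ℕ) → List ℕ
elemsS k s = map s (upTo k)

-- δ'(i) = δ_{i+1} (0-indexed difference sequence, i = 0,…,k-1):
-- δ'(i) = s_{i+1} - s_i for i+1 < k, and δ'(k-1) = π(S) = d - s_{k-1}.
δ : (d k : ℕ) → (s : ℕ → ℕ) → ℕ → ℕ
δ d k s i = if suc i <ᵇ k then s (suc i) ∸ s i else d ∸ s i

-- reduction mod k for arguments a < 2k
cyc : ℕ → ℕ → ℕ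
cyc k a = if a <ᵇ k then a else a ∸ k

-- m-th element (m = 0,…,k-1) of S^(j): the partial sums of the difference
-- vector [δ_{k-j+1}, …, δ_{k-j-1}] (1-indexed, mod k), i.e. 0-indexed
-- δ'((k-j+i) mod k) for i = 0,…,k-2.
elemSj : (d k : ℕ) → (s : ℕ → ℕ) → (j m : ℕ) → ℕ
elemSj d k s j m = psum m (λ i → δ d k s (cyc k ((k ∸ j) + i)))

elemsSj : (d k : ℕ) → (s : ℕ → ℕ) → ℕ → List ℕ
elemsSj d k s j = map (elemSj d k s j) (upTo k)

Sj : (d k : ℕ) → (s : ℕ → ℕ) → ℕ → Subset d
Sj d k s j = setOf d (elemsSj d k s j)

-- positioning value of S^(j): δ_{k-j} (1-indexed) = δ'(k-j-1)
posSj : (d k : ℕ) → (s : ℕ → ℕ) → ℕ → ℕ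
posSj d k s j = δ d k s (k ∸ j ∸ 1)

blockElt : (d k : ℕ) → (s : ℕ → ℕ) → (j t : ℕ) → Subset d
blockElt d k s j t = setOf d (map (t +_) (elemsSj d k s j))

-- (x + ν) mod d, for x, ν < d
addMod : ℕ → ℕ → ℕ → ℕ
addMod d ν x = if (x + ν) <ᵇ d then x + ν else (x + ν) ∸ d

-- translate of S by ν ∈ ℤ/dℤ (ν represented by 0 ≤ ν < d)
translate : (d k : ℕ) → (s : ℕ → ℕ) → ℕ → Subset d
translate d k s ν = setOf d (map (addMod d ν) (elemsS k s))

module Submission where

-- Extend s periodically to the "lift"
--     lift i = s i        (i < k),      lift (k + i) = d + s i   (i < k),
-- so that the cyclic difference sequence δ is exactly the sequence of steps
-- of lift: lift (i + 1) = lift i + δ (i mod k) for i + 1 < 2k.  Telescoping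
-- then shows that S^(j), whose differences start at p = k - j, consists of
-- the numbers lift (p + m) - lift p.  Hence the block element {t | δ(S^(j))}
-- is the rotation i ↦ i + p of S shifted by ν = t + (d - lift p), i.e. the
-- translate S + ν, and 0 ≤ ν < d because t < δ(S^(j)) = lift p - lift (p-1).
-- Conversely, for ν < d the lift crosses the value d - ν between some lift q
-- and lift (q + 1), which determines the block (j = k - q - 1) containing
-- S + ν.  Finally, every block element starts at its offset t, so equal block
-- elements have equal offsets and equal shapes S^(j), and distinctness of the
-- S^(j) separates the blocks.

open import Defs
open import Data.Nat using (ℕ; zero; suc; _+_; _∸_; _≤_; _<_; _<ᵇ_; z≤n; s≤s)
open import Data.Nat.Properties
open import Data.Nat.Tactic.RingSolver using (solve-∀)
open import Data.Bool using (true; false; T; if_then_else_)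
open import Data.List using (List; map; upTo)
open import Data.List.Properties using (map-∘)
open import Data.Fin using (Fin; toℕ; fromℕ<)
open import Data.Fin.Properties using (toℕ-fromℕ<)
open import Data.Vec using (lookup)
open import Data.Vec.Properties using (tabulate-cong; lookup∘tabulate)
open import Data.List.Membership.DecPropositional _≟_ using (_∈_; _∈?_)
open import Data.List.Membership.Propositional.Properties using (∈-map⁺; ∈-map⁻; ∈-upTo⁺; ∈-upTo⁻)
open import Relation.Nullary using (Dec; yes; no; does)
open import Relation.Nullary.Decidable using (dec-true; dec-false)
open import Data.Empty using (⊥-elim)
open import Data.Sum using (_⊎_; inj₁; inj₂)
open import Data.Product using (Σ; _×_; _,_; proj₁; proj₂)
open import Function using (_∘_)
open import Relation.Binary.PropositionalEquality

<ᵇ-then : ∀ {A : Set} {a n} {x y : A} → a < n → (if a <ᵇ n then x else y) ≡ x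
<ᵇ-then {a = a} {n} h with a <ᵇ n | <⇒<ᵇ h
... | true  | _  = refl
... | false | ()

<ᵇ-else : ∀ {A : Set} {a n} {x y : A} → n ≤ a → (if a <ᵇ n then x else y) ≡ y
<ᵇ-else {a = a} {n} h with a <ᵇ n in eq
... | true  = ⊥-elim (<⇒≱ (<ᵇ⇒< a n (subst T (sym eq) _)) h)
... | false = refl

does-agree : ∀ {P Q : Set} (p : Dec P) (q : Dec Q) → (P → Q) → (Q → P) → does p ≡ does q
does-agree (yes a)  q f g = sym (dec-true q (f a))
does-agree (no ¬a) q f g = sym (dec-false q (¬a ∘ g))

does-transfer : ∀ {P Q : Set} (p : Dec P) (q : Dec Q) → does p ≡ does q → P → Q
does-transfer (yes _)  (yes b) _  _ = b
does-transfer (no ¬a) _       _  a = ⊥-elim (¬a a)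
does-transfer (yes _)  (no _)  () _

setOf-ext : ∀ d (xs ys : List ℕ) → (∀ x → x ∈ xs → x ∈ ys) → (∀ x → x ∈ ys → x ∈ xs) →
  setOf d xs ≡ setOf d ys
setOf-ext d xs ys f g = tabulate-cong λ i → does-agree (toℕ i ∈? xs) (toℕ i ∈? ys) (f (toℕ i)) (g (toℕ i))

setOf-member : ∀ d (xs ys : List ℕ) → setOf d xs ≡ setOf d ys → ∀ x → x < d → x ∈ xs → x ∈ ys
setOf-member d xs ys eq x x<d x∈xs = subst (_∈ ys) (toℕ-fromℕ< x<d) (does-transfer (toℕ i ∈? xs) (toℕ i ∈? ys) bits
  (subst (_∈ xs) (sym (toℕ-fromℕ< x<d)) x∈xs))
  where
  i : Fin d
  i = fromℕ< x<d
  bits : does (toℕ i ∈? xs) ≡ does (toℕ i ∈? ys)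
  bits = trans (sym (lookup∘tabulate _ i)) (trans (cong (λ v → lookup v i) eq) (lookup∘tabulate _ i))

setOf-reindex : ∀ d k (f g σ : ℕ → ℕ) →
  (∀ m → m < k → σ m < k × f m ≡ g (σ m)) →
  (∀ i → i < k → Σ ℕ λ m → m < k × σ m ≡ i) →
  setOf d (map f (upTo k)) ≡ setOf d (map g (upTo k))
setOf-reindex d k f g σ into onto = setOf-ext d _ _ forth back
  where
  forth : ∀ x → x ∈ map f (upTo k) → x ∈ map g (upTo k)
  forth x x∈ with ∈-map⁻ f x∈
  ... | m , m∈ , refl with into m (∈-upTo⁻ m∈)
  ... | σm<k , fm≡ = subst (_∈ map g (upTo k)) (sym fm≡) (∈-map⁺ g (∈-upTo⁺ σm<k))
  back : ∀ x → x ∈ map g (upTo k) → x ∈ map f (upTo k)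
  back x x∈ with ∈-map⁻ g x∈
  ... | i , i∈ , refl with onto i (∈-upTo⁻ i∈)
  ... | m , m<k , refl = subst (_∈ map f (upTo k)) (proj₂ (into m m<k)) (∈-map⁺ f (∈-upTo⁺ m<k))

shifted-above : ∀ t (ys : List ℕ) x → x ∈ map (t +_) ys → t ≤ x
shifted-above t ys x x∈ with ∈-map⁻ (t +_) x∈
... | y , _ , refl = m≤m+n t y

telescope : ∀ (g f : ℕ → ℕ) a m → (∀ i → i < m → g (suc (a + i)) ≡ g (a + i) + f (a + i)) →
  g (a + m) ≡ g a + psum m (λ i → f (a + i))
telescope g f a zero    _    = trans (cong g (+-identityʳ a)) (sym (+-identityʳ (g a)))
telescope g f a (suc m) step = begin
  g (a + suc m)                                     ≡⟨ cong g (+-suc a m) ⟩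
  g (suc (a + m))                                   ≡⟨ step m ≤-refl ⟩
  g (a + m) + f (a + m)                             ≡⟨ cong (_+ f (a + m)) (telescope g f a m (λ i i<m → step i (m<n⇒m<1+n i<m))) ⟩
  g a + psum m (λ i → f (a + i)) + f (a + m)        ≡⟨ +-assoc (g a) _ _ ⟩
  g a + (psum m (λ i → f (a + i)) + f (a + m))      ∎
  where open ≡-Reasoning

crossing : ∀ (g : ℕ → ℕ) n w → g 0 < w → w ≤ g n → Σ ℕ λ q → q < n × g q < w × w ≤ g (suc q)
crossing g zero    w g0<w w≤g0 = ⊥-elim (<⇒≱ g0<w w≤g0)
crossing g (suc n) w g0<w w≤gn with w ≤? g n
... | no  w≰gn = n , ≤-refl , ≰⇒> w≰gn , w≤gn
... | yes w≤gn with crossing g n w g0<w w≤gn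
...   | q , q<n , below , above = q , m<n⇒m<1+n q<n , below , above

addMod-reduces : ∀ d ν x y → y < d → (x + ν ≡ y ⊎ x + ν ≡ y + d) → addMod d ν x ≡ y
addMod-reduces d ν x y y<d (inj₁ refl) = <ᵇ-then y<d
addMod-reduces d ν x y y<d (inj₂ eq)   = trans (<ᵇ-else (subst (d ≤_) (sym eq) (m≤n+m d y)))
  (trans (cong (_∸ d) eq) (m+n∸n≡m y d))

∸-telescope : ∀ w L d → w ≤ L → L ≤ d → (L ∸ w) + (d ∸ L) ≡ d ∸ w
∸-telescope w L d w≤L L≤d = begin
  (L ∸ w) + (d ∸ L) ≡⟨ +-comm (L ∸ w) (d ∸ L) ⟩
  (d ∸ L) + (L ∸ w) ≡⟨ sym (+-∸-assoc (d ∸ L) w≤L) ⟩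
  (d ∸ L) + L ∸ w   ≡⟨ cong (_∸ w) (m∸n+n≡m L≤d) ⟩
  d ∸ w             ∎
  where open ≡-Reasoning

shift-below : ∀ t P d → t < P → P ≤ d → t + (d ∸ P) < d
shift-below t P d t<P P≤d = subst (t + (d ∸ P) <_) (m+[n∸m]≡n P≤d) (+-monoˡ-< (d ∸ P) t<P)

shift-wraps : ∀ P e t d → P ≤ d → (P + e) + (t + (d ∸ P)) ≡ (t + e) + d
shift-wraps P e t d P≤d with m≤n⇒∃[o]m+o≡n P≤d
... | u , refl rewrite m+n∸m≡n P u = rearrange P e t u
  where
  rearrange : ∀ P e t u → (P + e) + (t + u) ≡ (t + e) + (P + u)
  rearrange = solve-∀

suc-pred-∸ : ∀ {j k} → j < k → suc (k ∸ j ∸ 1) ≡ k ∸ j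
suc-pred-∸ {zero}  {suc k} _       = refl
suc-pred-∸ {suc j} {suc k} (s≤s h) = suc-pred-∸ h

module Rotation (d k : ℕ) (s : ℕ → ℕ) (s0 : s 0 ≡ 0)
  (inc : ∀ i → suc i < k → s i < s (suc i)) (bnd : ∀ i → i < k → s i < d) where

  lift : ℕ → ℕ
  lift i = if i <ᵇ k then s i else d + s (i ∸ k)

  lift-below : ∀ {i} → i < k → lift i ≡ s i
  lift-below = <ᵇ-then

  lift-above : ∀ i → lift (k + i) ≡ d + s i
  lift-above i = trans (<ᵇ-else (m≤m+n k i)) (cong (λ a → d + s a) (m+n∸m≡n k i))

  lift-top : lift k ≡ d
  lift-top = trans (cong lift (sym (+-identityʳ k))) (trans (lift-above 0) (trans (cong (d +_) s0) (+-identityʳ d)))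

  cyc-below : ∀ {i} → i < k → cyc k i ≡ i
  cyc-below = <ᵇ-then

  cyc-above : ∀ i → cyc k (k + i) ≡ i
  cyc-above i = trans (<ᵇ-else (m≤m+n k i)) (m+n∸m≡n k i)

  cyc-bound : ∀ a → a < k + k → cyc k a < k
  cyc-bound a a<2k with a <? k
  ... | yes a<k = subst (_< k) (sym (cyc-below a<k)) a<k
  ... | no  a≮k with m≤n⇒∃[o]m+o≡n (≮⇒≥ a≮k)
  ...   | r , refl = subst (_< k) (sym (cyc-above r)) (+-cancelˡ-< k r k a<2k)

  lift-cyc : ∀ i → lift i ≡ s (cyc k i) ⊎ lift i ≡ d + s (cyc k i)
  lift-cyc i with i <ᵇ k
  ... | true  = inj₁ refl
  ... | false = inj₂ refl

  lift-step : ∀ i → suc i < k + k → lift (suc i) ≡ lift i + δ d k s (cyc k i)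
  lift-step i h with suc i <? k
  ... | yes i+1<k = begin
    lift (suc i)             ≡⟨ lift-below i+1<k ⟩
    s (suc i)                ≡⟨ sym (m+[n∸m]≡n (<⇒≤ (inc i i+1<k))) ⟩
    s i + (s (suc i) ∸ s i)  ≡⟨ cong₂ _+_ (sym (lift-below i<k)) (sym (<ᵇ-then i+1<k)) ⟩
    lift i + δ d k s i       ≡⟨ cong (λ a → lift i + δ d k s a) (sym (cyc-below i<k)) ⟩
    lift i + δ d k s (cyc k i) ∎
    where
    open ≡-Reasoning
    i<k = <-trans (n<1+n i) i+1<k
  ... | no i+1≮k with i <? k
  ...   | yes i<k = begin
    lift (suc i)             ≡⟨ cong lift i+1≡k ⟩
    lift k                   ≡⟨ lift-top ⟩
    d                        ≡⟨ sym (m+[n∸m]≡n (<⇒≤ (bnd i i<k))) ⟩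
    s i + (d ∸ s i)          ≡⟨ cong₂ _+_ (sym (lift-below i<k)) (sym (<ᵇ-else (≮⇒≥ i+1≮k))) ⟩
    lift i + δ d k s i       ≡⟨ cong (λ a → lift i + δ d k s a) (sym (cyc-below i<k)) ⟩
    lift i + δ d k s (cyc k i) ∎
    where
    open ≡-Reasoning
    i+1≡k = ≤-antisym i<k (≮⇒≥ i+1≮k)
  ...   | no i≮k with m≤n⇒∃[o]m+o≡n (≮⇒≥ i≮k)
  ...     | r , refl = begin
    lift (suc (k + r))                ≡⟨ cong lift (sym (+-suc k r)) ⟩
    lift (k + suc r)                  ≡⟨ lift-above (suc r) ⟩
    d + s (suc r)                     ≡⟨ cong (d +_) (sym (m+[n∸m]≡n (<⇒≤ (inc r r+1<k)))) ⟩
    d + (s r + (s (suc r) ∸ s r))     ≡⟨ sym (+-assoc d (s r) _) ⟩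
    d + s r + (s (suc r) ∸ s r)       ≡⟨ cong₂ _+_ (sym (lift-above r)) (sym (<ᵇ-then r+1<k)) ⟩
    lift (k + r) + δ d k s r          ≡⟨ cong (λ a → lift (k + r) + δ d k s a) (sym (cyc-above r)) ⟩
    lift (k + r) + δ d k s (cyc k (k + r)) ∎
    where
    open ≡-Reasoning
    r+1<k : suc r < k
    r+1<k = +-cancelˡ-< k (suc r) k (subst (_< k + k) (sym (+-suc k r)) h)

  lift-telescope : ∀ a m → a + m < k + k → lift (a + m) ≡ lift a + psum m (λ i → δ d k s (cyc k (a + i)))
  lift-telescope a m h = telescope lift (δ d k s ∘ cyc k) a m
    λ i i<m → lift-step (a + i) (≤-<-trans (subst (_≤ a + m) (+-suc a i) (+-monoʳ-≤ a i<m)) h)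

  k<2k : ∀ {i} → i < k → k < k + k
  k<2k i<k = m<m+n k (≤-<-trans z≤n i<k)

  lift-mono : ∀ {a b} → a ≤ b → b < k + k → lift a ≤ lift b
  lift-mono {a} a≤b b<2k with m≤n⇒∃[o]m+o≡n a≤b
  ... | n , refl = subst (lift a ≤_) (sym (lift-telescope a n b<2k)) (m≤m+n (lift a) _)

  rotation-point : ∀ {j m} → j < k → m < k → lift (k ∸ j + m) ≡ lift (k ∸ j) + elemSj d k s j m
  rotation-point {j} {m} _ m<k = lift-telescope (k ∸ j) m (+-mono-≤-< (m∸n≤m k j) m<k)

  posSj-step : ∀ {j} → j < k → lift (k ∸ j) ≡ lift (k ∸ j ∸ 1) + posSj d k s j
  posSj-step {j} j<k = begin
    lift (k ∸ j)                                  ≡⟨ cong lift (sym p≡) ⟩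
    lift (suc q)                                  ≡⟨ lift-step q (≤-<-trans q+1≤k (k<2k j<k)) ⟩
    lift q + δ d k s (cyc k q)                    ≡⟨ cong (λ a → lift q + δ d k s a) (cyc-below q+1≤k) ⟩
    lift q + posSj d k s j                        ∎
    where
    open ≡-Reasoning
    q = k ∸ j ∸ 1
    p≡ : suc q ≡ k ∸ j
    p≡ = suc-pred-∸ j<k
    q+1≤k : suc q ≤ k
    q+1≤k = subst (_≤ k) (sym p≡) (m∸n≤m k j)

  rotation-onto : ∀ p i → p ≤ k → i < k → Σ ℕ λ m → m < k × cyc k (p + m) ≡ i
  rotation-onto p i p≤k i<k with p ≤? i
  ... | yes p≤i = i ∸ p , ≤-<-trans (m∸n≤m i p) i<k , trans (cong (cyc k) (m+[n∸m]≡n p≤i)) (cyc-below i<k)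
  ... | no  p≰i = (k ∸ p) + i , m<k , trans (cong (cyc k) wraps) (cyc-above i)
    where
    wraps : p + ((k ∸ p) + i) ≡ k + i
    wraps = trans (sym (+-assoc p (k ∸ p) i)) (cong (_+ i) (m+[n∸m]≡n p≤k))
    m<k : (k ∸ p) + i < k
    m<k = subst ((k ∸ p) + i <_) (m∸n+n≡m p≤k) (+-monoʳ-< (k ∸ p) (≰⇒> p≰i))

  -- The translation amount carrying S onto the block element {t | δ(S^(j))}.
  shift : ℕ → ℕ → ℕ
  shift j t = t + (d ∸ lift (k ∸ j))

  lift-start≤d : ∀ {j} → j < k → lift (k ∸ j) ≤ d
  lift-start≤d {j} j<k = subst (lift (k ∸ j) ≤_) lift-top (lift-mono (m∸n≤m k j) (k<2k j<k))

  block-entry : ∀ {j t m} → j < k → t < posSj d k s j → m < k →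
    t + elemSj d k s j m < d × addMod d (shift j t) (s (cyc k (k ∸ j + m))) ≡ t + elemSj d k s j m
  block-entry {j} {t} {m} j<k t<pos m<k = y<d , addMod-reduces d (shift j t) x y y<d reduces
    where
    p = k ∸ j
    q = k ∸ j ∸ 1
    e = elemSj d k s j m
    y = t + e
    x = s (cyc k (p + m))
    p≡ : suc q ≡ p
    p≡ = suc-pred-∸ j<k
    q<k : q < k
    q<k = subst (_≤ k) (sym p≡) (m∸n≤m k j)
    p+m≤k+q : p + m ≤ k + q
    p+m≤k+q = subst (_≤ k + q) (trans (+-suc q m) (cong (_+ m) p≡))
      (subst (q + suc m ≤_) (+-comm q k) (+-monoʳ-≤ q m<k))
    -- the rotation ends before lift (k + q) = d + lift q, one period after q
    fits : lift q + (posSj d k s j + e) ≤ lift q + d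
    fits = begin
      lift q + (posSj d k s j + e)  ≡⟨ sym (+-assoc (lift q) _ e) ⟩
      lift q + posSj d k s j + e    ≡⟨ cong (_+ e) (sym (posSj-step j<k)) ⟩
      lift p + e                    ≡⟨ sym (rotation-point j<k m<k) ⟩
      lift (p + m)                  ≤⟨ lift-mono p+m≤k+q (+-monoʳ-< k q<k) ⟩
      lift (k + q)                  ≡⟨ lift-above q ⟩
      d + s q                       ≡⟨ cong (d +_) (sym (lift-below q<k)) ⟩
      d + lift q                    ≡⟨ +-comm d (lift q) ⟩
      lift q + d                    ∎
      where open ≤-Reasoning
    y<d : y < d
    y<d = <-≤-trans (+-monoˡ-< e t<pos) (+-cancelˡ-≤ (lift q) _ _ fits)
    wrapped : lift (p + m) + shift j t ≡ y + d
    wrapped = trans (cong (_+ shift j t) (rotation-point j<k m<k)) (shift-wraps (lift p) e t d (lift-start≤d j<k))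
    reduces : x + shift j t ≡ y ⊎ x + shift j t ≡ y + d
    reduces with lift-cyc (p + m)
    ... | inj₁ L≡x   = inj₂ (trans (cong (_+ shift j t) (sym L≡x)) wrapped)
    ... | inj₂ L≡d+x = inj₁ (+-cancelˡ-≡ d _ _ (begin
      d + (x + shift j t)  ≡⟨ sym (+-assoc d x _) ⟩
      d + x + shift j t    ≡⟨ cong (_+ shift j t) (sym L≡d+x) ⟩
      lift (p + m) + shift j t ≡⟨ wrapped ⟩
      y + d                ≡⟨ +-comm y d ⟩
      d + y                ∎))
      where open ≡-Reasoning

  shift-bound : ∀ {j t} → j < k → t < posSj d k s j → shift j t < d
  shift-bound {j} {t} j<k t<pos = shift-below t (lift (k ∸ j)) d t<start (lift-start≤d j<k)
    where
    t<start : t < lift (k ∸ j)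
    t<start = <-≤-trans t<pos (subst (posSj d k s j ≤_) (sym (posSj-step j<k)) (m≤n+m _ _))

  block-translate : ∀ {j t} → j < k → t < posSj d k s j → blockElt d k s j t ≡ translate d k s (shift j t)
  block-translate {j} {t} j<k t<pos = begin
    setOf d (map (t +_) (map (elemSj d k s j) (upTo k)))        ≡⟨ cong (setOf d) (sym (map-∘ (upTo k))) ⟩
    setOf d (map (λ m → t + elemSj d k s j m) (upTo k))          ≡⟨ setOf-reindex d k _ _ (λ m → cyc k (k ∸ j + m)) into onto ⟩
    setOf d (map (addMod d (shift j t) ∘ s) (upTo k))            ≡⟨ cong (setOf d) (map-∘ (upTo k)) ⟩
    setOf d (map (addMod d (shift j t)) (map s (upTo k)))        ∎
    where
    open ≡-Reasoning
    into : ∀ m → m < k → cyc k (k ∸ j + m) < k × t + elemSj d k s j m ≡ addMod d (shift j t) (s (cyc k (k ∸ j + m)))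
    into m m<k = cyc-bound _ (+-mono-≤-< (m∸n≤m k j) m<k) , sym (proj₂ (block-entry j<k t<pos m<k))
    onto : ∀ i → i < k → Σ ℕ λ m → m < k × cyc k (k ∸ j + m) ≡ i
    onto i i<k = rotation-onto (k ∸ j) i (m∸n≤m k j) i<k

  -- Blocks are pairwise disjoint: a block element has least point t and
  -- determines its shape S^(j).
  block-points-below : ∀ {j t} → j < k → t < posSj d k s j → ∀ x → x ∈ elemsSj d k s j → t + x < d
  block-points-below j<k t<pos x x∈ with ∈-map⁻ _ x∈
  ... | m , m∈ , refl = proj₁ (block-entry j<k t<pos (∈-upTo⁻ m∈))

  origin-in-shape : ∀ {j} → j < k → 0 ∈ elemsSj d k s j
  origin-in-shape {j} j<k = ∈-map⁺ (elemSj d k s j) (∈-upTo⁺ (≤-<-trans z≤n j<k))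

  offset-determined : ∀ {j j′ t t′} → j < k → t < posSj d k s j →
    blockElt d k s j t ≡ blockElt d k s j′ t′ → t′ ≤ t
  offset-determined {j} {j′} {t} {t′} j<k t<pos eq =
    shifted-above t′ (elemsSj d k s j′) t (setOf-member d _ _ eq t t<d t∈)
    where
    t∈ : t ∈ map (t +_) (elemsSj d k s j)
    t∈ = subst (_∈ map (t +_) (elemsSj d k s j)) (+-identityʳ t) (∈-map⁺ (t +_) (origin-in-shape j<k))
    t<d : t < d
    t<d = subst (_< d) (+-identityʳ t) (block-points-below j<k t<pos 0 (origin-in-shape j<k))

  shape-transfer : ∀ {j j′ t} → j < k → t < posSj d k s j →
    blockElt d k s j t ≡ blockElt d k s j′ t → ∀ x → x ∈ elemsSj d k s j → x ∈ elemsSj d k s j′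
  shape-transfer {j} {j′} {t} j<k t<pos eq x x∈
    with ∈-map⁻ (t +_) (setOf-member d _ _ eq (t + x) (block-points-below j<k t<pos x x∈) (∈-map⁺ (t +_) x∈))
  ... | y , y∈ , t+x≡t+y = subst (_∈ elemsSj d k s j′) (sym (+-cancelˡ-≡ t x y t+x≡t+y)) y∈

  blocks-disjoint : (∀ j j′ → j < k → j′ < k → Sj d k s j ≡ Sj d k s j′ → j ≡ j′) →
    ∀ j j′ t t′ → j < k → j′ < k → t < posSj d k s j → t′ < posSj d k s j′ →
    blockElt d k s j t ≡ blockElt d k s j′ t′ → j ≡ j′
  blocks-disjoint distinct j j′ t t′ j<k j′<k t<pos t′<pos eq
    with ≤-antisym (offset-determined {j′} {j} j′<k t′<pos (sym eq)) (offset-determined {j} {j′} j<k t<pos eq)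
  ... | refl = distinct j j′ j<k j′<k
    (setOf-ext d _ _ (shape-transfer {j} {j′} j<k t<pos eq) (shape-transfer {j′} {j} j′<k t′<pos (sym eq)))

  translate-in-block : ∀ {ν q} → ν < d → q < k → lift q < d ∸ ν → d ∸ ν ≤ lift (suc q) →
    Σ ℕ λ j → Σ ℕ λ t → j < k × t < posSj d k s j × translate d k s ν ≡ blockElt d k s j t
  translate-in-block {ν} {q} ν<d q<k below above =
    j , t , j<k , t<pos , trans (cong (translate d k s) (sym shift≡ν)) (sym (block-translate j<k t<pos))
    where
    w = d ∸ ν
    L = lift (suc q)
    j = k ∸ suc q
    t = L ∸ w
    j<k : j < k
    j<k = ∸-monoʳ-< (s≤s z≤n) q<k
    start≡ : k ∸ j ≡ suc q
    start≡ = m∸[m∸n]≡n q<k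
    step : L ≡ lift q + posSj d k s j
    step = trans (cong lift (sym start≡))
      (trans (posSj-step j<k) (cong (λ a → lift a + posSj d k s j) (cong (_∸ 1) start≡)))
    t<pos : t < posSj d k s j
    t<pos = subst (t <_) (trans (cong (_∸ lift q) step) (m+n∸m≡n (lift q) _)) (∸-monoʳ-< below above)
    L≤d : L ≤ d
    L≤d = subst (L ≤_) lift-top (lift-mono q<k (k<2k q<k))
    shift≡ν : shift j t ≡ ν
    shift≡ν = begin
      t + (d ∸ lift (k ∸ j)) ≡⟨ cong (λ a → t + (d ∸ lift a)) start≡ ⟩
      (L ∸ w) + (d ∸ L)      ≡⟨ ∸-telescope w L d above L≤d ⟩
      d ∸ w                  ≡⟨ m∸[m∸n]≡n (<⇒≤ ν<d) ⟩
      ν                      ∎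
      where open ≡-Reasoning

  translates-covered : 0 < k → ∀ ν → ν < d →
    Σ ℕ λ j → Σ ℕ λ t → j < k × t < posSj d k s j × translate d k s ν ≡ blockElt d k s j t
  translates-covered k>0 ν ν<d with crossing lift k (d ∸ ν) lift0<w w≤liftk
    where
    lift0<w : lift 0 < d ∸ ν
    lift0<w = subst (_< d ∸ ν) (sym (trans (lift-below k>0) s0)) (m<n⇒0<n∸m ν<d)
    w≤liftk : d ∸ ν ≤ lift k
    w≤liftk = subst (d ∸ ν ≤_) (sym lift-top) (m∸n≤m d ν)
  ... | q , q<k , below , above = translate-in-block ν<d q<k below above

proposition11 : (d k : ℕ) → 2 ≤ d → 1 ≤ k → k ≤ d →
    (s : ℕ → ℕ) →
    s 0 ≡ 0 →
    (∀ i → suc i < k → s i < s (suc i)) →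
    (∀ i → i < k → s i < d) →
    (∀ j j′ → j < k → j′ < k → Sj d k s j ≡ Sj d k s j′ → j ≡ j′) →
    ((∀ j t → j < k → t < posSj d k s j →
        Σ ℕ (λ ν → ν < d × blockElt d k s j t ≡ translate d k s ν))
    × (∀ ν → ν < d →
        Σ ℕ (λ j → Σ ℕ (λ t → j < k × t < posSj d k s j
          × translate d k s ν ≡ blockElt d k s j t)))
    × (∀ j j′ t t′ → j < k → j′ < k → t < posSj d k s j → t′ < posSj d k s j′ →
        blockElt d k s j t ≡ blockElt d k s j′ t′ → j ≡ j′))
proposition11 d k _ k≥1 _ s s0 inc bnd distinct =
  (λ j t j<k t<pos → shift j t , shift-bound j<k t<pos , block-translate j<k t<pos) ,
  translates-covered k≥1 ,
  blocks-disjoint distinct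
  where open Rotation d k s s0 inc bnd
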